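{- Let $\varphi,\psi\in\mathrm{Fm}_{\mathsf S}$ and $a,b\in Ag$ with $a\neq b$. Then: (1) $\vdash_{\mathsf S}S_{a,b}\varphi\land K_a\psi\land I_a\psi\to S_{a,b}(\varphi\land\psi)$; (2) $\vdash_{\mathsf S}S_{a,b}\varphi\land S_{a,b}\psi\to S_{a,b}(\varphi\land\psi)$; (3) $\vdash_{\mathsf S}S_{a,b}(\varphi\land\psi)\land S_{a,b}(\varphi\lor\psi)\to S_{a,b}\varphi\land S_{a,b}\psi$.
   Context: Let $Ag$ be a non-empty finite set of agents and $Var$ a countably infinite set of propositional variables. The formulas $\mathrm{Fm}_{\mathsf S}$ are generated by $\varphi::=p\mid\neg\varphi\mid\varphi\land\varphi\mid I_a\varphi\mid K_a\varphi\mid B_a\varphi$ ($p\in Var$, $a\in Ag$), with $\lor,\to$ classical abbreviations. The logic $\mathsf S$ ($\vdash_{\mathsf S}\varphi$ means $\varphi$ is derivable) has as axioms: all classical tautologies; for each $a$ and $\star\in\{K_a,B_a,I_a\}$, $\star(\varphi\to\psi)\to(\star\varphi\to\star\psi)$; $K_a\varphi\to\varphi$; $K_a\varphi\to K_aK_a\varphi$; $B_a\varphi\to\neg B_a\neg\varphi$; $K_a\varphi\to B_a\varphi$; $B_a\varphi\to K_aB_a\varphi$; $I_a\varphi\to\neg I_a\neg\varphi$; $I_a\varphi\to K_aI_a\varphi$; $I_a\varphi\to I_aK_a\varphi$; $I_a\varphi\to I_aI_a\varphi$; rules: modus ponens and necessitation for each $K_a,B_a,I_a$. $S_{a,b}\varphi:=K_a\varphi\land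 B_a\neg K_b\varphi\land I_a(\varphi\land\neg K_b\varphi)$. -}

module Defs where

open import Data.Nat using (ℕ; suc)
open import Data.Fin using (Fin)
open import Data.Bool using (Bool; true; false; not; _∧_)
open import Relation.Binary.PropositionalEquality using (_≡_)

module Logic (n : ℕ) where

  Ag : Set
  Ag = Fin (suc n)

  Var : Set
  Var = ℕ

  infixr 6 _⋀_
  infixr 5 _⋁_
  infixr 4 _⇒_

  data Fm : Set where
    var : Var → Fm
    ¬'  : Fm → Fm
    _⋀_ : Fm → Fm → Fm
    I   : Ag → Fm → Fm
    K   : Ag → Fm → Fm
    B   : Ag → Fm → Fm

  _⋁_ : Fm → Fm → Fm
  φ ⋁ ψ = ¬' (¬' φ ⋀ ¬' ψ)

  _⇒_ : Fm → Fm → Fm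
  φ ⇒ ψ = ¬' (φ ⋀ ¬' ψ)

  -- Classical tautologies: formulas true under every boolean assignment
  -- to their propositional-atomic parts (variables and modal subformulas
  -- are treated as atoms).
  eval : (Fm → Bool) → Fm → Bool
  eval v (var p) = v (var p)
  eval v (¬' φ) = not (eval v φ)
  eval v (φ ⋀ ψ) = eval v φ ∧ eval v ψ
  eval v (I a φ) = v (I a φ)
  eval v (K a φ) = v (K a φ)
  eval v (B a φ) = v (B a φ)

  Tautology : Fm → Set
  Tautology φ = (v : Fm → Bool) → eval v φ ≡ true

  data ⊢_ : Fm → Set where
    taut   : ∀ {φ} → Tautology φ → ⊢ φ
    K-dist : ∀ a φ ψ → ⊢ (K a (φ ⇒ ψ) ⇒ (K a φ ⇒ K a ψ))
    B-dist : ∀ a φ ψ → ⊢ (B a (φ ⇒ ψ) ⇒ (B a φ ⇒ B a ψ))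
    I-dist : ∀ a φ ψ → ⊢ (I a (φ ⇒ ψ) ⇒ (I a φ ⇒ I a ψ))
    K-T    : ∀ a φ → ⊢ (K a φ ⇒ φ)
    K-4    : ∀ a φ → ⊢ (K a φ ⇒ K a (K a φ))
    B-D    : ∀ a φ → ⊢ (B a φ ⇒ ¬' (B a (¬' φ)))
    KB     : ∀ a φ → ⊢ (K a φ ⇒ B a φ)
    BKB    : ∀ a φ → ⊢ (B a φ ⇒ K a (B a φ))
    I-D    : ∀ a φ → ⊢ (I a φ ⇒ ¬' (I a (¬' φ)))
    IKI    : ∀ a φ → ⊢ (I a φ ⇒ K a (I a φ))
    IIK    : ∀ a φ → ⊢ (I a φ ⇒ I a (K a φ))
    II4    : ∀ a φ → ⊢ (I a φ ⇒ I a (I a φ))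
    mp     : ∀ {φ ψ} → ⊢ (φ ⇒ ψ) → ⊢ φ → ⊢ ψ
    K-nec  : ∀ {φ} a → ⊢ φ → ⊢ K a φ
    B-nec  : ∀ {φ} a → ⊢ φ → ⊢ B a φ
    I-nec  : ∀ {φ} a → ⊢ φ → ⊢ I a φ

  S : Ag → Ag → Fm → Fm
  S a b φ = K a φ ⋀ B a (¬' (K b φ)) ⋀ I a (φ ⋀ ¬' (K b φ))

{-# OPTIONS --safe #-}
module Submission where

-- All three are schematic consequences of the normality of K_a, B_a, I_a.
-- The K-conjunct of S is monotone, the B-conjunct B_a ¬K_b χ is antitone
-- in χ (as K_b is monotone), and the I-conjunct combines two I_a-facts by
-- I_a χ ∧ I_a ξ → I_a(χ ∧ ξ).  Hence S_{a,b} χ follows from S_{a,b} of a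
-- stronger and of a weaker formula, which gives (3); (1) is the same
-- argument with the B-conjunct taken from φ, and (2) reduces to (1).

open import Defs
open import Data.Bool using (Bool; true; false; not; _∧_)
open import Data.Bool.Properties using (∧-conicalˡ; ∧-conicalʳ)
open import Data.Fin using (Fin; zero; suc)
open import Data.Nat using (ℕ; zero; suc)
open import Data.Product using (_×_; _,_)
open import Data.Vec using (Vec; []; _∷_; lookup; map)
open import Data.Vec.Properties using (lookup-map)
open import Relation.Nullary using (¬_)
open import Relation.Binary.PropositionalEquality using (_≡_; refl; cong; cong₂; sym; trans)

module Derivations (n : ℕ) where
  open Logic n

  private variable
    k : ℕ
    H X Y Z : Fm

  infixr 6 _‵∧_
  infixr 4 _‵⇒_

  -- Propositional schemata in k metavariables: an instance of a schema whose
  -- truth table is valid is derivable by `tautology s σ refl`.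
  data Schema (k : ℕ) : Set where
    atom : Fin k → Schema k
    ‵¬   : Schema k → Schema k
    _‵∧_ : Schema k → Schema k → Schema k

  _‵⇒_ : Schema k → Schema k → Schema k
  s ‵⇒ t = ‵¬ (s ‵∧ ‵¬ t)

  p : Schema (suc k)
  p = atom zero

  q : Schema (suc (suc k))
  q = atom (suc zero)

  r : Schema (suc (suc (suc k)))
  r = atom (suc (suc zero))

  instantiate : Schema k → Vec Fm k → Fm
  instantiate (atom i) σ = lookup σ i
  instantiate (‵¬ s)   σ = ¬' (instantiate s σ)
  instantiate (s ‵∧ t) σ = instantiate s σ ⋀ instantiate t σ

  truth : Vec Bool k → Schema k → Bool
  truth ρ (atom i) = lookup ρ i
  truth ρ (‵¬ s)   = not (truth ρ s)
  truth ρ (s ‵∧ t) = truth ρ s ∧ truth ρ t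

  eval-instantiate : ∀ (v : Fm → Bool) (s : Schema k) σ →
                     eval v (instantiate s σ) ≡ truth (map (eval v) σ) s
  eval-instantiate v (atom i) σ = sym (lookup-map i (eval v) σ)
  eval-instantiate v (‵¬ s)   σ = cong not (eval-instantiate v s σ)
  eval-instantiate v (s ‵∧ t) σ = cong₂ _∧_ (eval-instantiate v s σ) (eval-instantiate v t σ)

  everywhere : (k : ℕ) → (Vec Bool k → Bool) → Bool
  everywhere zero    f = f []
  everywhere (suc k) f = everywhere k (λ ρ → f (true ∷ ρ)) ∧ everywhere k (λ ρ → f (false ∷ ρ))

  everywhere-sound : ∀ k (f : Vec Bool k → Bool) → everywhere k f ≡ true → ∀ ρ → f ρ ≡ true
  everywhere-sound zero    f holds []          = holds
  everywhere-sound (suc k) f holds (true ∷ ρ)  =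
    everywhere-sound k _ (∧-conicalˡ _ _ holds) ρ
  everywhere-sound (suc k) f holds (false ∷ ρ) =
    everywhere-sound k _ (∧-conicalʳ (everywhere k (λ ρ → f (true ∷ ρ))) _ holds) ρ

  valid : Schema k → Bool
  valid {k} s = everywhere k (λ ρ → truth ρ s)

  tautology : (s : Schema k) (σ : Vec Fm k) → valid s ≡ true → ⊢ instantiate s σ
  tautology {k} s σ s-valid = taut λ v →
    trans (eval-instantiate v s σ) (everywhere-sound k _ s-valid (map (eval v) σ))

  infixr 9 _⨾_

  _⨾_ : ⊢ (X ⇒ Y) → ⊢ (Y ⇒ Z) → ⊢ (X ⇒ Z)
  _⨾_ {X} {Y} {Z} x⇒y y⇒z =
    mp (mp (tautology ((p ‵⇒ q) ‵⇒ (q ‵⇒ r) ‵⇒ (p ‵⇒ r)) (X ∷ Y ∷ Z ∷ []) refl) x⇒y) y⇒z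

  ⟨_,_⟩ : ⊢ (H ⇒ X) → ⊢ (H ⇒ Y) → ⊢ (H ⇒ X ⋀ Y)
  ⟨_,_⟩ {H} {X} {Y} h⇒x h⇒y =
    mp (mp (tautology ((p ‵⇒ q) ‵⇒ (p ‵⇒ r) ‵⇒ (p ‵⇒ q ‵∧ r)) (H ∷ X ∷ Y ∷ []) refl) h⇒x) h⇒y

  ⋀-elimˡ : ⊢ (X ⋀ Y ⇒ X)
  ⋀-elimˡ {X} {Y} = tautology (p ‵∧ q ‵⇒ p) (X ∷ Y ∷ []) refl

  ⋀-elimʳ : ⊢ (X ⋀ Y ⇒ Y)
  ⋀-elimʳ {X} {Y} = tautology (p ‵∧ q ‵⇒ q) (X ∷ Y ∷ []) refl

  ⋁-introˡ : ⊢ (X ⇒ X ⋁ Y)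
  ⋁-introˡ {X} {Y} = tautology (p ‵⇒ ‵¬ (‵¬ p ‵∧ ‵¬ q)) (X ∷ Y ∷ []) refl

  ⋁-introʳ : ⊢ (Y ⇒ X ⋁ Y)
  ⋁-introʳ {Y} {X} = tautology (q ‵⇒ ‵¬ (‵¬ p ‵∧ ‵¬ q)) (X ∷ Y ∷ []) refl

  uncurry : ⊢ (X ⇒ Y ⇒ Z) → ⊢ (X ⋀ Y ⇒ Z)
  uncurry {X} {Y} {Z} = mp (tautology ((p ‵⇒ q ‵⇒ r) ‵⇒ (p ‵∧ q ‵⇒ r)) (X ∷ Y ∷ Z ∷ []) refl)

  contraposition : ⊢ (X ⇒ Y) → ⊢ (¬' Y ⇒ ¬' X)
  contraposition {X} {Y} = mp (tautology ((p ‵⇒ q) ‵⇒ (‵¬ q ‵⇒ ‵¬ p)) (X ∷ Y ∷ []) refl)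

  module Normal (□ : Fm → Fm) (dist : ∀ φ ψ → ⊢ (□ (φ ⇒ ψ) ⇒ (□ φ ⇒ □ ψ)))
                (nec : ∀ {φ} → ⊢ φ → ⊢ □ φ) where

    □-mono : ⊢ (X ⇒ Y) → ⊢ (□ X ⇒ □ Y)
    □-mono {X} {Y} x⇒y = mp (dist X Y) (nec x⇒y)

    □-⋀ : ⊢ (□ X ⋀ □ Y ⇒ □ (X ⋀ Y))
    □-⋀ {X} {Y} = uncurry (□-mono pair ⨾ dist Y (X ⋀ Y))
      where
      pair : ⊢ (X ⇒ Y ⇒ X ⋀ Y)
      pair = tautology (p ‵⇒ q ‵⇒ p ‵∧ q) (X ∷ Y ∷ []) refl

  module _ {c : Ag} where
    open Normal (K c) (K-dist c) (K-nec c) public renaming (□-mono to K-mono; □-⋀ to K-⋀)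
    open Normal (B c) (B-dist c) (B-nec c) public using () renaming (□-mono to B-mono)
    open Normal (I c) (I-dist c) (I-nec c) public renaming (□-mono to I-mono; □-⋀ to I-⋀)

  module _ (a b : Ag) where

    S⇒K : ⊢ (S a b X ⇒ K a X)
    S⇒K = ⋀-elimˡ

    S⇒B : ⊢ (S a b X ⇒ B a (¬' (K b X)))
    S⇒B = ⋀-elimʳ ⨾ ⋀-elimˡ

    S⇒I : ⊢ (S a b X ⇒ I a (X ⋀ ¬' (K b X)))
    S⇒I = ⋀-elimʳ ⨾ ⋀-elimʳ

    S-intro : ⊢ (H ⇒ K a X) → ⊢ (H ⇒ B a (¬' (K b X))) → ⊢ (H ⇒ I a (X ⋀ ¬' (K b X))) →
              ⊢ (H ⇒ S a b X)
    S-intro h⇒k h⇒b h⇒i = ⟨ h⇒k , ⟨ h⇒b , h⇒i ⟩ ⟩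

    ¬K-antitone : ⊢ (X ⇒ Y) → ⊢ (¬' (K b Y) ⇒ ¬' (K b X))
    ¬K-antitone x⇒y = contraposition (K-mono x⇒y)

    S⇒K⋀I : ⊢ (S a b X ⇒ K a X ⋀ I a X)
    S⇒K⋀I = ⟨ S⇒K , S⇒I ⨾ I-mono ⋀-elimˡ ⟩

    S-⋀-K-I : ⊢ (S a b X ⋀ K a Y ⋀ I a Y ⇒ S a b (X ⋀ Y))
    S-⋀-K-I = S-intro
      (⟨ ⋀-elimˡ ⨾ S⇒K , ⋀-elimʳ ⨾ ⋀-elimˡ ⟩ ⨾ K-⋀)
      (⋀-elimˡ ⨾ S⇒B ⨾ B-mono (¬K-antitone ⋀-elimˡ))
      (⟨ ⋀-elimˡ ⨾ S⇒I , ⋀-elimʳ ⨾ ⋀-elimʳ ⟩ ⨾ I-⋀ ⨾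
        I-mono ⟨ ⟨ ⋀-elimˡ ⨾ ⋀-elimˡ , ⋀-elimʳ ⟩ , ⋀-elimˡ ⨾ ⋀-elimʳ ⨾ ¬K-antitone ⋀-elimˡ ⟩)

    S-⋀ : ⊢ (S a b X ⋀ S a b Y ⇒ S a b (X ⋀ Y))
    S-⋀ = ⟨ ⋀-elimˡ , ⋀-elimʳ ⨾ S⇒K⋀I ⟩ ⨾ S-⋀-K-I

    S-between : ⊢ (X ⇒ Y) → ⊢ (Y ⇒ Z) → ⊢ (S a b X ⋀ S a b Z ⇒ S a b Y)
    S-between x⇒y y⇒z = S-intro
      (⋀-elimˡ ⨾ S⇒K ⨾ K-mono x⇒y)
      (⋀-elimʳ ⨾ S⇒B ⨾ B-mono (¬K-antitone y⇒z))
      (⟨ ⋀-elimˡ ⨾ S⇒I , ⋀-elimʳ ⨾ S⇒I ⟩ ⨾ I-⋀ ⨾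
        I-mono ⟨ ⋀-elimˡ ⨾ ⋀-elimˡ ⨾ x⇒y , ⋀-elimʳ ⨾ ⋀-elimʳ ⨾ ¬K-antitone y⇒z ⟩)

    S-⋀-⋁ : ⊢ (S a b (X ⋀ Y) ⋀ S a b (X ⋁ Y) ⇒ S a b X ⋀ S a b Y)
    S-⋀-⋁ = ⟨ S-between ⋀-elimˡ ⋁-introˡ , S-between ⋀-elimʳ ⋁-introʳ ⟩

proposition9 : (n : ℕ) → let open Logic n in
    (φ ψ : Fm) (a b : Ag) → ¬ (a ≡ b) →
      (⊢ ((S a b φ ⋀ K a ψ ⋀ I a ψ) ⇒ S a b (φ ⋀ ψ)))
      × (⊢ ((S a b φ ⋀ S a b ψ) ⇒ S a b (φ ⋀ ψ)))
      × (⊢ ((S a b (φ ⋀ ψ) ⋀ S a b (φ ⋁ ψ)) ⇒ (S a b φ ⋀ S a b ψ)))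
proposition9 n φ ψ a b _ = S-⋀-K-I a b , S-⋀ a b , S-⋀-⋁ a b
  where open Derivations n
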